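{- Let $P\in\mathbb{Z}[x_1,\ldots,x_n]$ and let $(J_0,\ldots,J_\ell)$ be a Rado partition for $P$. Then for every $i\in\{0,1,\ldots,\ell\}$: (1) $J_i$ is convex in the sense that if $\alpha^{(1)},\ldots,\alpha^{(m)}\in J_i$ and $\lambda_1,\ldots,\lambda_m\in\mathbb{Q}$ satisfy $\lambda_1+\cdots+\lambda_m=1$ and $\lambda_1\alpha^{(1)}+\cdots+\lambda_m\alpha^{(m)}\in\mathrm{Supp}(P)$, then $\lambda_1\alpha^{(1)}+\cdots+\lambda_m\alpha^{(m)}\in J_i$; (2) every nonzero polynomial $p(z_1,\ldots,z_n)=a_1z_1+\cdots+a_nz_n$ in $E_{J_i}$ is partition regular, i.e. there exist $k\ge2$ and $1\le i_1<\cdots<i_k\le n$ such that $a_{i_1},\ldots,a_{i_k}$ are nonzero and $a_{i_1}+\cdots+a_{i_k}=0$; (3) if $\alpha,\beta\in J_i$ and $\ell(\alpha+\beta)\le2$, then $|\alpha|=|\beta|$.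
   Context: $\mathbb{N}=\{1,2,\ldots\}$, $\mathbb{N}_0=\mathbb{N}\cup\{0\}$. For $P=\sum_\alpha c_\alpha x^\alpha\in\mathbb{Z}[x_1,\ldots,x_n]$, $\mathrm{Supp}(P)=\{\alpha\in\mathbb{N}_0^n:c_\alpha\ne0\}$. For an index $\alpha\in\mathbb{N}_0^n$, $|\alpha|=\alpha_1+\cdots+\alpha_n$ and $\ell(\alpha)=|\{i:\alpha_i>0\}|$ (Hamming length). For $\alpha\in\mathbb{Z}^n$ let $p_\alpha(z_1,\ldots,z_n)=\alpha_1z_1+\cdots+\alpha_nz_n$, and for $J\subseteq\mathbb{N}_0^n$ let $E_J$ be the $\mathbb{Q}$-linear span of $\{p_{\alpha-\beta}:\alpha,\beta\in J\}$. A linear polynomial is partition regular if for every finite coloring of $\mathbb{N}$ there are infinitely many monochromatic sets $\{t_1,\ldots,t_n\}\subseteq\mathbb{N}$ with $p(t_1,\ldots,t_n)=0$. A positive linear map is $\phi:\mathbb{Z}^n\to\mathbb{Z}$, $\phi(\alpha)=t_1\alpha_1+\cdots+t_n\alpha_n$ with $t_i\in\mathbb{N}_0$; for a finite coloring $c$ of $\mathbb{N}_0$, $\phi$ is $c$-monochromatic if $\{t_1,\ldots,t_n\}$ is $c$-monochromatic. If $M_0<\cdots<M_\ell$ is the increasing enumeration of $\phi(\mathrm{Supp}(P))$, the partition of $\mathrm{Supp}(P)$ determined by $\phi$ is $(J_0,\ldots,J_\ell)$ with $J_i=\{\alpha\in\mathrm{Supp}(P):\phi(\alpha)=M_i\}$.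 A Rado partition of $P$ is an ordered tuple $(J_0,\ldots,J_\ell)$ such that for every finite coloring $c$ of $\mathbb{N}_0$ there are infinitely many $c$-monochromatic positive linear maps $\phi$ for which $(J_0,\ldots,J_\ell)$ is the partition of $\mathrm{Supp}(P)$ determined by $\phi$. -}

module Defs where

open import Level using (0ℓ)
open import Data.Nat as ℕ using (ℕ; zero; suc)
open import Data.Integer as ℤ using (ℤ; +_)
open import Data.Rational as ℚ using (ℚ; 0ℚ; 1ℚ)
open import Data.Fin as Fin using (Fin)
open import Data.Vec using (Vec; lookup)
open import Data.Vec.Properties using (≡-dec)
open import Data.List using (List; []; _∷_)
open import Data.List.Membership.Propositional using (_∉_)
open import Data.Product using (Σ; ∃; _×_; _,_)
open import Relation.Nullary using (¬_; yes; no)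
open import Relation.Binary.PropositionalEquality using (_≡_; _≢_)
open import Function.Bundles using (_⇔_)

-- A polynomial is a finite formal sum of terms c·x^β (duplicates allowed;
-- the coefficient of x^α is the sum of the coefficients of all terms x^α).
Poly : ℕ → Set
Poly n = List (ℤ × Vec ℕ n)

coeff : ∀ {n} → Poly n → Vec ℕ n → ℤ
coeff []             α = + 0
coeff ((c , β) ∷ P) α with ≡-dec ℕ._≟_ β α
... | yes _ = c ℤ.+ coeff P α
... | no  _ = coeff P α

_∈Supp_ : ∀ {n} → Vec ℕ n → Poly n → Set
α ∈Supp P = coeff P α ≢ + 0

sumℕ : ∀ {m} → (Fin m → ℕ) → ℕ
sumℕ {zero}  f = 0
sumℕ {suc m} f = f Fin.zero ℕ.+ sumℕ (λ k → f (Fin.suc k))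

sumℚ : ∀ {m} → (Fin m → ℚ) → ℚ
sumℚ {zero}  f = 0ℚ
sumℚ {suc m} f = f Fin.zero ℚ.+ sumℚ (λ k → f (Fin.suc k))

ℕtoℚ : ℕ → ℚ
ℕtoℚ b = (+ b) ℚ./ 1

∣_∣ₘ : ∀ {n} → Vec ℕ n → ℕ
∣ α ∣ₘ = sumℕ (lookup α)

hamming : ∀ {n} → Vec ℕ n → ℕ
hamming α = sumℕ (λ i → ind (lookup α i))
  where
  ind : ℕ → ℕ
  ind zero    = 0
  ind (suc _) = 1

_+ᵥ_ : ∀ {n} → Vec ℕ n → Vec ℕ n → Vec ℕ n
_+ᵥ_ = Data.Vec.zipWith ℕ._+_
  where import Data.Vec

posLin : ∀ {n} → Vec ℕ n → Vec ℕ n → ℕ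
posLin t α = sumℕ (λ i → lookup t i ℕ.* lookup α i)

Colouring : ℕ → Set
Colouring r = ℕ → Fin r

Monochromatic : ∀ {n r} → Colouring r → Vec ℕ n → Set
Monochromatic c t = ∀ i j → c (lookup t i) ≡ c (lookup t j)

Tuple : ℕ → ℕ → Set₁
Tuple n ℓ = Fin (suc ℓ) → Vec ℕ n → Set

DeterminedBy : ∀ {n ℓ} → Poly n → Vec ℕ n → Tuple n ℓ → Set
DeterminedBy {n} {ℓ} P t J =
  Σ (Fin (suc ℓ) → ℕ) λ M →
    (∀ i j → i Fin.< j → M i ℕ.< M j)
  × (∀ i → Σ (Vec ℕ n) λ α → α ∈Supp P × posLin t α ≡ M i)
  × (∀ α → α ∈Supp P → Σ (Fin (suc ℓ)) λ i → posLin t α ≡ M i)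
  × (∀ i α → J i α ⇔ (α ∈Supp P × posLin t α ≡ M i))

-- Rado partition: for every finite colouring c of ℕ₀ there are infinitely
-- many c-monochromatic positive linear maps determining (J₀,…,J_ℓ).
-- "Infinitely many": every finite list of maps misses one of them.
RadoPartition : ∀ {n ℓ} → Poly n → Tuple n ℓ → Set
RadoPartition {n} P J =
  ∀ (r : ℕ) (c : Colouring r) (L : List (Vec ℕ n)) →
    Σ (Vec ℕ n) λ t → t ∉ L × Monochromatic c t × DeterminedBy P t J

-- E_J : ℚ-span of {p_{α-β} : α, β ∈ J}; a linear form is its coefficient
-- vector a = (a₁,…,aₙ) ∈ ℚⁿ.

InSpanE : ∀ {n} → (Vec ℕ n → Set) → (Fin n → ℚ) → Set
InSpanE {n} Jᵢ a =
  Σ ℕ λ m → Σ (Fin m → ℚ) λ μ → Σ (Fin m → Vec ℕ n) λ α → Σ (Fin m → Vec ℕ n) λ β →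
    (∀ k → Jᵢ (α k)) × (∀ k → Jᵢ (β k))
    × (∀ j → a j ≡ sumℚ (λ k → μ k ℚ.* (ℕtoℚ (lookup (α k) j) ℚ.- ℕtoℚ (lookup (β k) j))))

RadoCondition : ∀ {n} → (Fin n → ℚ) → Set
RadoCondition {n} a =
  Σ ℕ λ k → Σ (Fin k → Fin n) λ ι →
    2 ℕ.≤ k
    × (∀ p q → p Fin.< q → ι p Fin.< ι q)
    × (∀ p → a (ι p) ≢ 0ℚ)
    × sumℚ (λ p → a (ι p)) ≡ 0ℚ

NonzeroForm : ∀ {n} → (Fin n → ℚ) → Set
NonzeroForm a = ¬ (∀ j → a j ≡ 0ℚ)

{-# OPTIONS --safe #-}

-- A positive linear map φ_t determining (J₀,…,J_ℓ) is constant on each Jᵢ, and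
-- linear. For (2), every a ∈ E_{Jᵢ} satisfies
-- Σ a_j t_j = 0 for each such t; clearing denominators turns a into an integer
-- vector g. Choose a prime p > Σ |g_j| and colour x > 0 by its last nonzero
-- digit in base p. A monochromatic t with positive entries has t_j = p^{v_j} u_j
-- with u_j ≡ d (mod p) for a common d ≢ 0; if m is the least v_j with g_j ≠ 0,
-- reducing Σ g_j t_j = 0 modulo p^{m+1} gives p ∣ d Σ_{v_j = m} g_j, and as that
-- sum is smaller than p in absolute value it vanishes: this is Rado's column
-- condition. For (3), apply (2) to p_{α-β}: its support lies in that of α+β,
-- which has at most two points, so the zero-sum set of the column condition is
-- the whole support and |α| - |β| = Σ (α_j - β_j) = 0.

module Submission where

open import Defs
open import Level using (0ℓ)
open import Algebra.Bundles using (CommutativeMonoid; Ring)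
import Algebra.Properties.CommutativeMonoid.Sum as CommutativeMonoidSum
import Algebra.Properties.Semiring.Sum as SemiringSum
open import Data.Bool using (if_then_else_)
open import Data.Nat as ℕ using (ℕ; zero; suc; _≤_; _<_; _^_; _!; z≤n; s≤s; NonZero)
import Data.Nat.Properties as ℕP
open import Data.Nat.Divisibility as ℕ∣ using (_∤_; _∣?_)
open import Data.Nat.DivMod using (_%_; _/_; _mod_; m≡m%n+[m/n]*n; m*n%n≡0)
open import Data.Nat.Induction using (<-wellFounded)
open import Data.Nat.Primality using (Prime; prime⇒nonZero; prime⇒nonTrivial; ¬prime[1]; euclidsLemma)
open import Data.Nat.Primality.Factorisation using (factorise)
open import Data.Integer as ℤ using (ℤ; +_; 0ℤ; ∣_∣)
import Data.Integer.Properties as ℤP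
open import Data.Integer.Divisibility.Signed as ℤ∣ using (divides)
open import Data.Integer.Tactic.RingSolver using (solve-∀)
open import Data.Rational as ℚ using (ℚ; 0ℚ; 1ℚ; ↥_; ↧_; ↧ₙ_)
import Data.Rational.Properties as ℚP
import Data.Rational.Unnormalised as ℚᵘ
import Data.Rational.Unnormalised.Properties as ℚᵘP
open import Data.Rational.Solver using (module +-*-Solver)
open import Data.Fin as Fin using (Fin; zero; suc; toℕ; punchIn; punchOut)
import Data.Fin.Properties as FinP
open import Data.Vec using (Vec; []; _∷_; lookup; replicate; tabulate)
import Data.Vec.Properties as VecP
import Data.Vec.Functional as Vector
open import Data.List using ([]; _∷_; filter; allFin)
open import Data.List.Relation.Unary.All as All using (_∷_)
open import Data.List.Relation.Unary.All.Properties using (all-filter)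
open import Data.List.Relation.Unary.Any using (here)
open import Data.List.Membership.Propositional.Properties using (∈-filter⁺; ∈-allFin)
open import Data.Product using (∃; _×_; _,_; proj₁; proj₂)
open import Data.Sum using (inj₂; [_,_]′)
open import Data.Empty using (⊥-elim)
open import Function using (_∘_; flip; Injective; it; Equivalence)
open import Induction.WellFounded using (Acc; acc)
open import Relation.Nullary using (¬_; Dec; yes; no; does; contradiction; ¬?)
open import Relation.Nullary.Decidable using (_×-dec_)
open import Relation.Unary using (Pred; Decidable)
open import Relation.Binary using (tri<; tri≈; tri>)
open import Relation.Binary.PropositionalEquality
  using (_≡_; _≢_; refl; sym; trans; cong; cong₂; subst; subst₂; module ≡-Reasoning)

module Σℕ = SemiringSum ℕP.+-*-semiring
module Σℤ = SemiringSum ℤP.+-*-semiring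
module Σℚ = SemiringSum (Ring.semiring ℚP.+-*-ring)

sumℚ≡sum : ∀ {m} (f : Fin m → ℚ) → sumℚ f ≡ Σℚ.sum f
sumℚ≡sum {zero}  f = refl
sumℚ≡sum {suc m} f = cong (f zero ℚ.+_) (sumℚ≡sum (f ∘ suc))

-- Finite sums and subsets of Fin n

module InjectiveFamily {k n} (ι : Fin (suc k) → Fin (suc n)) (ι-injective : Injective _≡_ _≡_ ι) where

  head≢tail : ∀ q → ι zero ≢ ι (suc q)
  head≢tail q eq with ι-injective eq
  ... | ()

  rest : Fin k → Fin n
  rest q = punchOut (head≢tail q)

  rest-injective : Injective _≡_ _≡_ rest
  rest-injective eq =
    FinP.suc-injective (ι-injective (FinP.punchOut-injective (head≢tail _) (head≢tail _) eq))

  punchIn-rest : ∀ q → punchIn (ι zero) (rest q) ≡ ι (suc q)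
  punchIn-rest q = FinP.punchIn-punchOut (head≢tail q)

  rest-hits : ∀ {q i} → ι (suc q) ≡ punchIn (ι zero) i → rest q ≡ i
  rest-hits eq = trans (FinP.punchOut-cong′ (ι zero) eq) (FinP.punchOut-punchIn (ι zero))

module _ {c ℓ} (M : CommutativeMonoid c ℓ) where

  open CommutativeMonoid M using (Carrier; _≈_; _∙_; ε; ∙-congˡ; setoid) renaming (trans to ≈-trans)
  open CommutativeMonoidSum M
  open import Relation.Binary.Reasoning.Setoid setoid

  sum-reindex : ∀ {k n} (f : Fin n → Carrier) (ι : Fin k → Fin n) → Injective _≡_ _≡_ ι →
                (∀ j → (∀ q → ι q ≢ j) → f j ≈ ε) → sum f ≈ sum (f ∘ ι)
  sum-reindex {zero}  {n}     f ι _ vanish =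
    ≈-trans (sum-cong-≋ (λ j → vanish j (λ ()))) (sum-replicate-zero n)
  sum-reindex {suc k} {zero}  f ι _ _ with ι zero
  ... | ()
  sum-reindex {suc k} {suc n} f ι ι-injective vanish = begin
    sum f                                           ≈⟨ sum-remove f ⟩
    f (ι zero) ∙ sum (f ∘ punchIn (ι zero))         ≈⟨ ∙-congˡ (sum-reindex _ rest rest-injective vanish-rest) ⟩
    f (ι zero) ∙ sum (f ∘ punchIn (ι zero) ∘ rest)  ≡⟨ cong (f (ι zero) ∙_) (sum-cong-≗ (cong f ∘ punchIn-rest)) ⟩
    sum (f ∘ ι)                                     ∎
    where
    open InjectiveFamily ι ι-injective
    vanish-rest : ∀ i → (∀ q → rest q ≢ i) → f (punchIn (ι zero) i) ≈ ε
    vanish-rest i missed = vanish (punchIn (ι zero) i) λ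
      { zero    eq → FinP.punchInᵢ≢i (ι zero) i (sym eq)
      ; (suc q) eq → missed q (rest-hits eq) }

injective-count≤sum : ∀ {k n} (f : Fin n → ℕ) (ι : Fin k → Fin n) → Injective _≡_ _≡_ ι →
                      (∀ q → 1 ≤ f (ι q)) → k ≤ Σℕ.sum f
injective-count≤sum {zero}          f ι _ _ = z≤n
injective-count≤sum {suc k} {zero}  f ι _ _ with ι zero
... | ()
injective-count≤sum {suc k} {suc n} f ι ι-injective positive = begin
  1 ℕ.+ k                                        ≤⟨ ℕP.+-mono-≤ (positive zero) (injective-count≤sum _ rest rest-injective positive-rest) ⟩
  f (ι zero) ℕ.+ Σℕ.sum (f ∘ punchIn (ι zero))  ≡⟨ Σℕ.sum-remove f ⟨
  Σℕ.sum f                                       ∎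
  where
  open ℕP.≤-Reasoning
  open InjectiveFamily ι ι-injective
  positive-rest : ∀ q → 1 ≤ f (punchIn (ι zero) (rest q))
  positive-rest q = subst (λ j → 1 ≤ f j) (sym (punchIn-rest q)) (positive (suc q))

cons-injective : ∀ {k n} {j : Fin n} {ι : Fin k → Fin n} → Injective _≡_ _≡_ ι → (∀ q → ι q ≢ j) →
                 Injective _≡_ _≡_ (j Vector.∷ ι)
cons-injective _           _      {zero}  {zero}  _  = refl
cons-injective _           missed {zero}  {suc r} eq = contradiction (sym eq) (missed r)
cons-injective _           missed {suc q} {zero}  eq = contradiction eq (missed q)
cons-injective ι-injective _      {suc q} {suc r} eq = cong suc (ι-injective eq)

strictMono⇒injective : ∀ {k n} (ι : Fin k → Fin n) → (∀ q r → q Fin.< r → ι q Fin.< ι r) →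
                       Injective _≡_ _≡_ ι
strictMono⇒injective ι strictMono {q} {r} eq with FinP.<-cmp q r
... | tri< q<r _ _ = contradiction eq (FinP.<⇒≢ (strictMono q r q<r))
... | tri≈ _ q≡r _ = q≡r
... | tri> _ _ r<q = contradiction (sym eq) (FinP.<⇒≢ (strictMono r q r<q))

record Enumeration {n} (P : Pred (Fin n) 0ℓ) : Set where
  field
    size : ℕ
    index : Fin size → Fin n
    index-strictMono : ∀ q r → q Fin.< r → index q Fin.< index r
    index-valid : ∀ q → P (index q)
    index-complete : ∀ {j} → P j → ∃ λ q → index q ≡ j

enumerate : ∀ {n} {P : Pred (Fin n) 0ℓ} → Decidable P → Enumeration P
enumerate {zero} P? = record
  { size = 0 ; index = λ () ; index-strictMono = λ () ; index-valid = λ ()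
  ; index-complete = λ {j} _ → ⊥-elim (FinP.¬Fin0 j) }
enumerate {suc n} {P} P? with P? zero | enumerate (P? ∘ suc)
... | yes P0 | E = record
  { size = suc size ; index = index⁺ ; index-strictMono = strictMono⁺
  ; index-valid = valid⁺ ; index-complete = complete⁺ }
  where
  open Enumeration E
  index⁺ : Fin (suc size) → Fin (suc n)
  index⁺ zero    = zero
  index⁺ (suc q) = suc (index q)
  strictMono⁺ : ∀ q r → q Fin.< r → index⁺ q Fin.< index⁺ r
  strictMono⁺ zero    (suc r) _         = s≤s z≤n
  strictMono⁺ (suc q) (suc r) (s≤s q<r) = s≤s (index-strictMono q r q<r)
  valid⁺ : ∀ q → P (index⁺ q)
  valid⁺ zero    = P0
  valid⁺ (suc q) = index-valid q
  complete⁺ : ∀ {j} → P j → ∃ λ q → index⁺ q ≡ j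
  complete⁺ {zero}  _  = zero , refl
  complete⁺ {suc j} Pj = let q , eq = index-complete Pj in suc q , cong suc eq
... | no ¬P0 | E = record
  { size = size ; index = suc ∘ index ; index-strictMono = λ q r q<r → s≤s (index-strictMono q r q<r)
  ; index-valid = index-valid ; index-complete = complete⁺ }
  where
  open Enumeration E
  complete⁺ : ∀ {j} → P j → ∃ λ q → suc (index q) ≡ j
  complete⁺ {zero}  P0 = contradiction P0 ¬P0
  complete⁺ {suc j} Pj = let q , eq = index-complete Pj in q , cong suc eq

∃-minimal : ∀ {n} {P : Pred (Fin n) 0ℓ} → Decidable P → (v : Fin n → ℕ) → ∃ P →
            ∃ λ i → P i × ∀ {j} → P j → v i ≤ v j
∃-minimal {n} P? v (j₀ , Pj₀) =
  argmin v j₀ candidates , argmin-all v Pj₀ (all-filter P? (allFin n)) ,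
  λ Pj → All.lookup (f[argmin]≤f[xs] j₀ candidates) (∈-filter⁺ P? (∈-allFin _) Pj)
  where
  open import Data.List.Extrema ℕP.≤-totalOrder
  candidates = filter P? (allFin n)

-- Integers and divisibility

fromℤ : ℤ → ℚ
fromℤ z = z ℚ./ 1

module _ where
  open import Data.Rational.Base using (_+_; _*_)

  private
    toℚᵘ-fromℤ : ∀ z → ℚ.toℚᵘ (fromℤ z) ℚᵘ.≃ ℚᵘ.mkℚᵘ z 0
    toℚᵘ-fromℤ z = ℚP.toℚᵘ-fromℚᵘ (ℚᵘ.mkℚᵘ z 0)

  fromℤ-+ : ∀ a b → fromℤ (a ℤ.+ b) ≡ fromℤ a + fromℤ b
  fromℤ-+ a b = ℚP.toℚᵘ-injective (begin
    ℚ.toℚᵘ (fromℤ (a ℤ.+ b))                 ≈⟨ toℚᵘ-fromℤ (a ℤ.+ b) ⟩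
    ℚᵘ.mkℚᵘ (a ℤ.+ b) 0                       ≈⟨ ℚᵘ.*≡* (identity a b) ⟩
    ℚᵘ.mkℚᵘ a 0 ℚᵘ.+ ℚᵘ.mkℚᵘ b 0              ≈⟨ ℚᵘP.+-cong (toℚᵘ-fromℤ a) (toℚᵘ-fromℤ b) ⟨
    ℚ.toℚᵘ (fromℤ a) ℚᵘ.+ ℚ.toℚᵘ (fromℤ b)    ≈⟨ ℚP.toℚᵘ-homo-+ (fromℤ a) (fromℤ b) ⟨
    ℚ.toℚᵘ (fromℤ a + fromℤ b)               ∎)
    where
    open ℚᵘP.≃-Reasoning
    identity : ∀ a b → (a ℤ.+ b) ℤ.* + 1 ≡ (a ℤ.* + 1 ℤ.+ b ℤ.* + 1) ℤ.* + 1
    identity = solve-∀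

  fromℤ-* : ∀ a b → fromℤ (a ℤ.* b) ≡ fromℤ a * fromℤ b
  fromℤ-* a b = ℚP.toℚᵘ-injective (begin
    ℚ.toℚᵘ (fromℤ (a ℤ.* b))                 ≈⟨ toℚᵘ-fromℤ (a ℤ.* b) ⟩
    ℚᵘ.mkℚᵘ a 0 ℚᵘ.* ℚᵘ.mkℚᵘ b 0              ≈⟨ ℚᵘP.*-cong (toℚᵘ-fromℤ a) (toℚᵘ-fromℤ b) ⟨
    ℚ.toℚᵘ (fromℤ a) ℚᵘ.* ℚ.toℚᵘ (fromℤ b)    ≈⟨ ℚP.toℚᵘ-homo-* (fromℤ a) (fromℤ b) ⟨
    ℚ.toℚᵘ (fromℤ a * fromℤ b)               ∎)
    where open ℚᵘP.≃-Reasoning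

  fromℤ-injective : ∀ {a b} → fromℤ a ≡ fromℤ b → a ≡ b
  fromℤ-injective {a} {b} eq with ℚᵘP.≃-trans (ℚᵘP.≃-sym (toℚᵘ-fromℤ a)) (ℚᵘP.≃-trans (ℚP.toℚᵘ-cong eq) (toℚᵘ-fromℤ b))
  ... | ℚᵘ.*≡* a*1≡b*1 = trans (sym (ℤP.*-identityʳ a)) (trans a*1≡b*1 (ℤP.*-identityʳ b))

  fromℤ-↥ : ∀ q → fromℤ (↥ q) ≡ fromℤ (↧ q) * q
  fromℤ-↥ q@record{} = ℚP.toℚᵘ-injective (begin
    ℚ.toℚᵘ (fromℤ (↥ q))                 ≈⟨ toℚᵘ-fromℤ (↥ q) ⟩
    ℚᵘ.mkℚᵘ (↥ q) 0                       ≈⟨ ℚᵘ.*≡* (identity (↥ q) (↧ₙ q)) ⟩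
    ℚᵘ.mkℚᵘ (↧ q) 0 ℚᵘ.* ℚ.toℚᵘ q         ≈⟨ ℚᵘP.*-congʳ (toℚᵘ-fromℤ (↧ q)) ⟨
    ℚ.toℚᵘ (fromℤ (↧ q)) ℚᵘ.* ℚ.toℚᵘ q    ≈⟨ ℚP.toℚᵘ-homo-* (fromℤ (↧ q)) q ⟨
    ℚ.toℚᵘ (fromℤ (↧ q) * q)             ∎)
    where
    open ℚᵘP.≃-Reasoning
    commute : ∀ n e → n ℤ.* e ≡ (e ℤ.* n) ℤ.* + 1
    commute = solve-∀
    identity : ∀ n d → n ℤ.* + (1 ℕ.* d) ≡ (+ d ℤ.* n) ℤ.* + 1
    identity n d = trans (cong (λ k → n ℤ.* + k) (ℕP.*-identityˡ d)) (commute n (+ d))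

  ℕtoℚ-* : ∀ a b → ℕtoℚ (a ℕ.* b) ≡ ℕtoℚ a * ℕtoℚ b
  ℕtoℚ-* a b = trans (cong fromℤ (ℤP.pos-* a b)) (fromℤ-* (+ a) (+ b))

  ℕtoℚ-injective : ∀ {a b} → ℕtoℚ a ≡ ℕtoℚ b → a ≡ b
  ℕtoℚ-injective = ℤP.+-injective ∘ fromℤ-injective

  ℕtoℚ-sum : ∀ {m} (f : Fin m → ℕ) → ℕtoℚ (sumℕ f) ≡ Σℚ.sum (ℕtoℚ ∘ f)
  ℕtoℚ-sum {zero}  f = refl
  ℕtoℚ-sum {suc m} f = begin
    ℕtoℚ (f zero ℕ.+ sumℕ (f ∘ suc))   ≡⟨ cong fromℤ (ℤP.pos-+ (f zero) _) ⟩
    fromℤ (+ f zero ℤ.+ + sumℕ (f ∘ suc))  ≡⟨ fromℤ-+ (+ f zero) (+ sumℕ (f ∘ suc)) ⟩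
    ℕtoℚ (f zero) + ℕtoℚ (sumℕ (f ∘ suc)) ≡⟨ cong (_+_ (ℕtoℚ (f zero))) (ℕtoℚ-sum (f ∘ suc)) ⟩
    Σℚ.sum (ℕtoℚ ∘ f)                   ∎
    where open ≡-Reasoning

  fromℤ-sum : ∀ {m} (g : Fin m → ℤ) → fromℤ (Σℤ.sum g) ≡ Σℚ.sum (fromℤ ∘ g)
  fromℤ-sum {zero}  g = refl
  fromℤ-sum {suc m} g = trans (fromℤ-+ (g zero) _) (cong (_+_ (fromℤ (g zero))) (fromℤ-sum (g ∘ suc)))

onlyOn : ∀ {n} {P : Pred (Fin n) 0ℓ} → Decidable P → (Fin n → ℤ) → Fin n → ℤ
onlyOn P? g j = if does (P? j) then g j else 0ℤ

onlyOn-∈ : ∀ {n} {P : Pred (Fin n) 0ℓ} (P? : Decidable P) (g : Fin n → ℤ) {j} → P j → onlyOn P? g j ≡ g j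
onlyOn-∈ P? g {j} Pj with P? j
... | yes _  = refl
... | no ¬Pj = contradiction Pj ¬Pj

onlyOn-∉ : ∀ {n} {P : Pred (Fin n) 0ℓ} (P? : Decidable P) (g : Fin n → ℤ) {j} → ¬ P j → onlyOn P? g j ≡ 0ℤ
onlyOn-∉ P? g {j} ¬Pj with P? j
... | yes Pj = contradiction Pj ¬Pj
... | no _   = refl

∣onlyOn∣≤∣∣ : ∀ {n} {P : Pred (Fin n) 0ℓ} (P? : Decidable P) (g : Fin n → ℤ) j → ∣ onlyOn P? g j ∣ ≤ ∣ g j ∣
∣onlyOn∣≤∣∣ P? g j with P? j
... | yes _ = ℕP.≤-refl
... | no  _ = z≤n

∣sum∣≤sum∣∣ : ∀ {n} (h g : Fin n → ℤ) → (∀ j → ∣ h j ∣ ≤ ∣ g j ∣) → ∣ Σℤ.sum h ∣ ≤ Σℕ.sum (∣_∣ ∘ g)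
∣sum∣≤sum∣∣ {zero}  h g _   = z≤n
∣sum∣≤sum∣∣ {suc n} h g h≤g =
  ℕP.≤-trans (ℤP.∣i+j∣≤∣i∣+∣j∣ (h zero) _) (ℕP.+-mono-≤ (h≤g zero) (∣sum∣≤sum∣∣ (h ∘ suc) (g ∘ suc) (h≤g ∘ suc)))

∣-sum : ∀ {n k} (f : Fin n → ℤ) → (∀ j → k ℤ∣.∣ f j) → k ℤ∣.∣ Σℤ.sum f
∣-sum {zero}  f _   = divides 0ℤ refl
∣-sum {suc n} f k∣f = ℤ∣.∣m∣n⇒∣m+n (k∣f zero) (∣-sum (f ∘ suc) (k∣f ∘ suc))

^-∣-^ : ∀ x {a b} → a ≤ b → x ^ a ℕ∣.∣ x ^ b
^-∣-^ x {a} {b} a≤b = ℕ∣.divides (x ^ (b ℕ.∸ a)) (begin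
  x ^ b                     ≡⟨ cong (x ^_) (ℕP.m+[n∸m]≡n a≤b) ⟨
  x ^ (a ℕ.+ (b ℕ.∸ a))     ≡⟨ ℕP.^-distribˡ-+-* x a (b ℕ.∸ a) ⟩
  x ^ a ℕ.* x ^ (b ℕ.∸ a)   ≡⟨ ℕP.*-comm (x ^ a) _ ⟩
  x ^ (b ℕ.∸ a) ℕ.* x ^ a   ∎)
  where open ≡-Reasoning

module _ where
  open import Data.Integer.Base using (_+_; _*_; _-_; -_)

  sum-sub-scaled : ∀ {n} c (x y : Fin n → ℤ) → Σℤ.sum (λ j → x j - c * y j) ≡ Σℤ.sum x - c * Σℤ.sum y
  sum-sub-scaled {zero}  c x y = base c
    where
    base : ∀ c → 0ℤ ≡ 0ℤ - c * 0ℤ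
    base = solve-∀
  sum-sub-scaled {suc n} c x y =
    trans (cong (_+_ (x zero - c * y zero)) (sum-sub-scaled c (x ∘ suc) (y ∘ suc))) (step c (x zero) (y zero) _ _)
    where
    step : ∀ c a b S T → (a - c * b) + (S - c * T) ≡ (a + S) - c * (b + T)
    step = solve-∀

  digit-identity : ∀ g P d q p → g * + (P ℕ.* (d ℕ.+ q ℕ.* p)) - + (d ℕ.* P) * g ≡ g * + q * + (p ℕ.* P)
  digit-identity g P d q p = begin
    g * + (P ℕ.* (d ℕ.+ q ℕ.* p)) - + (d ℕ.* P) * g     ≡⟨ cong₂ (λ a b → g * a - b * g) expand (ℤP.pos-* d P) ⟩
    g * (+ P * (+ d + + q * + p)) - + d * + P * g        ≡⟨ identity g (+ P) (+ d) (+ q) (+ p) ⟩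
    g * + q * (+ p * + P)                                ≡⟨ cong (_*_ (g * + q)) (ℤP.pos-* p P) ⟨
    g * + q * + (p ℕ.* P)                                ∎
    where
    open ≡-Reasoning
    expand : + (P ℕ.* (d ℕ.+ q ℕ.* p)) ≡ + P * (+ d + + q * + p)
    expand = trans (ℤP.pos-* P _) (cong (_*_ (+ P)) (trans (ℤP.pos-+ d _) (cong (_+_ (+ d)) (ℤP.pos-* q p))))
    identity : ∀ g P d q p → g * (P * (d + q * p)) - d * P * g ≡ g * q * (p * P)
    identity = solve-∀

-- Primes and the last-digit colouring

∃prime> : ∀ n → ∃ λ p → Prime p × n < p
∃prime> n with factorise (suc (n !))
... | record { factors = [] ; isFactorisation = eq } =
  contradiction (sym (ℕP.suc-injective eq)) (ℕP.<⇒≢ (ℕP.1≤n! n))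
... | record { factors = p ∷ _ ; isFactorisation = eq ; factorsPrime = p-prime ∷ _ } with n ℕP.<? p
...   | yes n<p = p , p-prime , n<p
...   | no  n≮p = contradiction (subst Prime (ℕ∣.∣1⇒≡1 p∣1) p-prime) ¬prime[1]
  where
  p∣p! : ∀ {q} → Prime q → q ℕ∣.∣ q !
  p∣p! {suc q} _ = ℕ∣.m∣m*n (q !)
  p∣1 : p ℕ∣.∣ 1
  p∣1 = ℕ∣.∣m+n∣m⇒∣n (subst (p ℕ∣.∣_) (trans (sym eq) (ℕP.+-comm 1 (n !))) (ℕ∣.m∣m*n _))
                     (ℕ∣.∣-trans (p∣p! p-prime) (ℕ∣.m≤n⇒m!∣n! (ℕP.≮⇒≥ n≮p)))

record PowerDecomposition (p x : ℕ) : Set where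
  constructor decomposition
  field
    valuation unit : ℕ
    p∤unit : p ∤ unit
    x≡p^valuation*unit : x ≡ p ^ valuation ℕ.* unit

decompose : ∀ {p} → 1 < p → ∀ x → .{{NonZero x}} → PowerDecomposition p x
decompose {p} 1<p x = go x (<-wellFounded x)
  where
  go : ∀ x → .{{NonZero x}} → Acc _<_ x → PowerDecomposition p x
  go x (acc rec) with p ∣? x
  ... | no  p∤x = decomposition 0 x p∤x (sym (ℕP.*-identityˡ x))
  ... | yes (ℕ∣.divides q x≡q*p) = decomposition (suc valuation) unit p∤unit x≡p^[1+valuation]*unit
    where
    instance
      q≢0 : NonZero q
      q≢0 = ℕP.m*n≢0⇒m≢0 q {{subst NonZero x≡q*p it}}
    open PowerDecomposition (go q (rec (subst (q <_) (sym x≡q*p) (ℕP.m<m*n q p 1<p))))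
    x≡p^[1+valuation]*unit : x ≡ p ℕ.* p ^ valuation ℕ.* unit
    x≡p^[1+valuation]*unit = begin
      x                                ≡⟨ x≡q*p ⟩
      q ℕ.* p                          ≡⟨ cong (ℕ._* p) x≡p^valuation*unit ⟩
      p ^ valuation ℕ.* unit ℕ.* p     ≡⟨ ℕP.*-comm _ p ⟩
      p ℕ.* (p ^ valuation ℕ.* unit)   ≡⟨ ℕP.*-assoc p _ unit ⟨
      p ℕ.* p ^ valuation ℕ.* unit     ∎
      where open ≡-Reasoning

record ZeroSumSubset {n} (g : Fin n → ℤ) : Set₁ where
  field
    Member : Pred (Fin n) 0ℓ
    member? : Decidable Member
    nonempty : ∃ Member
    member⇒nonzero : ∀ {j} → Member j → g j ≢ 0ℤ
    sum-onlyOn≡0 : Σℤ.sum (onlyOn member? g) ≡ 0ℤ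

module LastDigitColouring {p : ℕ} (p-prime : Prime p) where

  open import Data.Integer.Base using (_*_; _-_; -_)

  instance
    p≢0 : NonZero p
    p≢0 = prime⇒nonZero p-prime

  1<p : 1 < p
  1<p = ℕ.nonTrivial⇒n>1 p {{prime⇒nonTrivial p-prime}}

  lastDigit : ℕ → Fin p
  lastDigit zero      = 0 mod p
  lastDigit x@(suc _) = PowerDecomposition.unit (decompose 1<p x) mod p

  toℕ-lastDigit : ∀ x → .{{_ : NonZero x}} → toℕ (lastDigit x) ≡ PowerDecomposition.unit (decompose 1<p x) % p
  toℕ-lastDigit (suc x) = FinP.toℕ-fromℕ< _

  lastDigit-nonzero : ∀ x → .{{_ : NonZero x}} → lastDigit x ≢ lastDigit 0
  lastDigit-nonzero x eq = p∤unit (ℕ∣.m%n≡0⇒n∣m unit p (begin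
    unit % p            ≡⟨ toℕ-lastDigit x ⟨
    toℕ (lastDigit x)   ≡⟨ cong toℕ eq ⟩
    toℕ (0 mod p)       ≡⟨ FinP.toℕ-fromℕ< _ ⟩
    0 % p               ≡⟨ m*n%n≡0 0 p ⟩
    0                   ∎))
    where
    open PowerDecomposition (decompose 1<p x)
    open ≡-Reasoning

  prime∣scaled⇒zero : ∀ {d m σ} → p ∤ d → ∣ σ ∣ < p → + (p ℕ.* p ^ m) ℤ∣.∣ + (d ℕ.* p ^ m) * σ → σ ≡ 0ℤ
  prime∣scaled⇒zero {d} {m} {σ} p∤d ∣σ∣<p p^[1+m]∣ =
    [ flip contradiction p∤d , ℤP.∣i∣≡0⇒i≡0 ∘ small-multiple≡0 ∣σ∣<p ]′ (euclidsLemma d ∣ σ ∣ p-prime p∣d∣σ∣)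
    where
    rearrange : ∀ a b c → a * b * c ≡ a * c * b
    rearrange = solve-∀
    p∣dσ : + p ℤ∣.∣ + d * σ
    p∣dσ = ℤ∣.*-cancelʳ-∣ (+ (p ^ m)) {{ℕP.m^n≢0 p m}} (subst₂ ℤ∣._∣_ (ℤP.pos-* p (p ^ m))
             (trans (cong (_* σ) (ℤP.pos-* d (p ^ m))) (rearrange (+ d) (+ (p ^ m)) σ)) p^[1+m]∣)
    p∣d∣σ∣ : p ℕ∣.∣ d ℕ.* ∣ σ ∣
    p∣d∣σ∣ = subst (p ℕ∣.∣_) (ℤP.abs-* (+ d) σ) (ℤ∣.∣⇒∣ᵤ p∣dσ)
    small-multiple≡0 : ∀ {a b} → b < a → a ℕ∣.∣ b → b ≡ 0
    small-multiple≡0 {b = zero}  _   _   = refl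
    small-multiple≡0 {b = suc _} b<a a∣b = contradiction a∣b (ℕ∣.>⇒∤ b<a)

  zeroSumSubset : ∀ {n d} (g : Fin n → ℤ) (v u : Fin n → ℕ) → p ∤ d → (∀ j → u j % p ≡ d) →
                  Σℕ.sum (∣_∣ ∘ g) < p → Σℤ.sum (λ j → g j * + (p ^ v j ℕ.* u j)) ≡ 0ℤ →
                  ∀ jₘ → g jₘ ≢ 0ℤ → (∀ {j} → g j ≢ 0ℤ → v jₘ ≤ v j) → ZeroSumSubset g
  zeroSumSubset {n} {d} g v u p∤d u%p≡d bound Σ≡0 jₘ g[jₘ]≢0 minimal = record
    { Member = Member ; member? = member? ; nonempty = jₘ , g[jₘ]≢0 , refl
    ; member⇒nonzero = proj₁ ; sum-onlyOn≡0 = σ≡0 }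
    where
    m = v jₘ

    Member : Pred (Fin n) 0ℓ
    Member j = g j ≢ 0ℤ × v j ≡ m
    member? : Decidable Member
    member? j = ¬? (g j ℤ.≟ 0ℤ) ×-dec (v j ℕ.≟ m)

    σ = Σℤ.sum (onlyOn member? g)
    c = + (d ℕ.* p ^ m)

    -- Modulo p^(m+1), each term g_j t_j is d p^m g_j on members and 0 elsewhere.
    Divisible : Fin n → ℤ → Set
    Divisible j s = + (p ℕ.* p ^ m) ℤ∣.∣ g j * + (p ^ v j ℕ.* u j) - c * s

    member-divisible : ∀ {j} → v j ≡ m → Divisible j (g j)
    member-divisible {j} v≡m = divides (g j * + (u j / p)) (begin
      g j * + (p ^ v j ℕ.* u j) - c * g j
        ≡⟨ cong (λ e → g j * + e - c * g j) (cong₂ (λ a b → p ^ a ℕ.* b) v≡m u≡d+[u/p]*p) ⟩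
      g j * + (p ^ m ℕ.* (d ℕ.+ u j / p ℕ.* p)) - c * g j
        ≡⟨ digit-identity (g j) (p ^ m) d (u j / p) p ⟩
      g j * + (u j / p) * + (p ℕ.* p ^ m) ∎)
      where
      open ≡-Reasoning
      u≡d+[u/p]*p : u j ≡ d ℕ.+ u j / p ℕ.* p
      u≡d+[u/p]*p = trans (m≡m%n+[m/n]*n (u j) p) (cong (ℕ._+ u j / p ℕ.* p) (u%p≡d j))

    zero-divisible : ∀ {j} → g j ≡ 0ℤ → Divisible j 0ℤ
    zero-divisible {j} g≡0 = divides 0ℤ (trans (cong (λ e → e * + (p ^ v j ℕ.* u j) - c * 0ℤ) g≡0)
                                               (vanish (+ (p ^ v j ℕ.* u j)) c (+ (p ℕ.* p ^ m))))
      where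
      vanish : ∀ x c k → 0ℤ * x - c * 0ℤ ≡ 0ℤ * k
      vanish = solve-∀

    deep-divisible : ∀ {j} → m < v j → Divisible j 0ℤ
    deep-divisible {j} m<v = subst (+ (p ℕ.* p ^ m) ℤ∣.∣_) (sym (minus-zero _ c))
      (ℤ∣.∣n⇒∣m*n (g j) (ℤ∣.∣ᵤ⇒∣ (ℕ∣.∣-trans (^-∣-^ p m<v) (ℕ∣.m∣m*n (u j)))))
      where
      minus-zero : ∀ x c → x - c * 0ℤ ≡ x
      minus-zero = solve-∀

    termwise : ∀ j → Divisible j (onlyOn member? g j)
    termwise j = byCases (member? j) (g j ℤ.≟ 0ℤ)
      where
      byCases : Dec (Member j) → Dec (g j ≡ 0ℤ) → Divisible j (onlyOn member? g j)
      byCases (yes M)  _        = subst (Divisible j) (sym (onlyOn-∈ member? g M)) (member-divisible (proj₂ M))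
      byCases (no ¬M) (yes g≡0) = subst (Divisible j) (sym (onlyOn-∉ member? g ¬M)) (zero-divisible g≡0)
      byCases (no ¬M) (no g≢0)  = subst (Divisible j) (sym (onlyOn-∉ member? g ¬M))
        (deep-divisible (ℕP.≤∧≢⇒< (minimal g≢0) (λ m≡v → ¬M (g≢0 , sym m≡v))))

    p^[1+m]∣cσ : + (p ℕ.* p ^ m) ℤ∣.∣ c * σ
    p^[1+m]∣cσ = subst (+ (p ℕ.* p ^ m) ℤ∣.∣_) (negate-sub (c * σ))
      (ℤ∣.∣m⇒∣-m (subst (+ (p ℕ.* p ^ m) ℤ∣.∣_) Σtermwise≡-cσ (∣-sum _ termwise)))
      where
      negate-sub : ∀ x → - (0ℤ - x) ≡ x
      negate-sub = solve-∀
      Σtermwise≡-cσ : Σℤ.sum (λ j → g j * + (p ^ v j ℕ.* u j) - c * onlyOn member? g j) ≡ 0ℤ - c * σ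
      Σtermwise≡-cσ = trans (sum-sub-scaled c (λ j → g j * + (p ^ v j ℕ.* u j)) (onlyOn member? g)) (cong (_- c * σ) Σ≡0)

    σ≡0 : σ ≡ 0ℤ
    σ≡0 = prime∣scaled⇒zero {m = m} p∤d (ℕP.≤-<-trans (∣sum∣≤sum∣∣ _ g (∣onlyOn∣≤∣∣ member? g)) bound) p^[1+m]∣cσ

  monochromatic⇒zeroSumSubset : ∀ {n} (g : Fin n → ℤ) (t : Fin n → ℕ) → Σℕ.sum (∣_∣ ∘ g) < p →
    (∀ j → t j ≢ 0) → (∀ j k → lastDigit (t j) ≡ lastDigit (t k)) →
    Σℤ.sum (λ j → g j * + t j) ≡ 0ℤ → ∃ (λ j → g j ≢ 0ℤ) → ZeroSumSubset g
  monochromatic⇒zeroSumSubset g t bound t≢0 mono Σ≡0 nonzero@(j₀ , _) =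
    zeroSumSubset g (valuation ∘ D) (unit ∘ D) p∤d unit%p≡d bound Σ≡0′ jₘ g[jₘ]≢0 minimal
    where
    open PowerDecomposition
    D : ∀ j → PowerDecomposition p (t j)
    D j = decompose 1<p (t j) {{ℕ.≢-nonZero (t≢0 j)}}
    jₘ,minimal = ∃-minimal (λ j → ¬? (g j ℤ.≟ 0ℤ)) (valuation ∘ D) nonzero
    jₘ = proj₁ jₘ,minimal
    g[jₘ]≢0 = proj₁ (proj₂ jₘ,minimal)
    minimal = proj₂ (proj₂ jₘ,minimal)
    d = unit (D j₀) % p
    unit%p≡d : ∀ j → unit (D j) % p ≡ d
    unit%p≡d j = trans (sym (toℕ-lastDigit (t j) {{ℕ.≢-nonZero (t≢0 j)}}))
                   (trans (cong toℕ (mono j j₀)) (toℕ-lastDigit (t j₀) {{ℕ.≢-nonZero (t≢0 j₀)}}))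
    p∤d : p ∤ d
    p∤d p∣d = p∤unit (D j₀) (subst (p ℕ∣.∣_) (sym (m≡m%n+[m/n]*n (unit (D j₀)) p))
                (ℕ∣.∣m∣n⇒∣m+n p∣d (ℕ∣.n∣m*n (unit (D j₀) / p))))
    Σ≡0′ : Σℤ.sum (λ j → g j * + (p ^ valuation (D j) ℕ.* unit (D j))) ≡ 0ℤ
    Σ≡0′ = trans (Σℤ.sum-cong-≗ (λ j → cong (λ x → g j * + x) (sym (x≡p^valuation*unit (D j))))) Σ≡0

-- Rado's column condition

zeroSum⇒2≤length : ∀ {k} (f : Fin k → ℤ) {q} → f q ≢ 0ℤ → Σℤ.sum f ≡ 0ℤ → 2 ≤ k
zeroSum⇒2≤length {suc zero}    f {zero} f0≢0 Σ≡0 = contradiction (trans (sym (ℤP.+-identityʳ (f zero))) Σ≡0) f0≢0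
zeroSum⇒2≤length {suc (suc k)} _ _ _ = s≤s (s≤s z≤n)

ZeroSumSubset⇒RadoCondition : ∀ {n} {g : Fin n → ℤ} → ZeroSumSubset g → RadoCondition (fromℤ ∘ g)
ZeroSumSubset⇒RadoCondition {g = g} S =
  size , index , zeroSum⇒2≤length (g ∘ index) (member⇒nonzero (index-valid q₁)) Σg∘index≡0 ,
  index-strictMono , (λ q → member⇒nonzero (index-valid q) ∘ fromℤ-injective) ,
  trans (sumℚ≡sum (fromℤ ∘ g ∘ index)) (trans (sym (fromℤ-sum (g ∘ index))) (cong fromℤ Σg∘index≡0))
  where
  open ZeroSumSubset S
  open Enumeration (enumerate member?)
  q₁ = proj₁ (index-complete (proj₂ nonempty))
  vanish : ∀ j → (∀ q → index q ≢ j) → onlyOn member? g j ≡ 0ℤ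
  vanish j missed = onlyOn-∉ member? g λ Mj → let q , eq = index-complete Mj in missed q eq
  Σg∘index≡0 : Σℤ.sum (g ∘ index) ≡ 0ℤ
  Σg∘index≡0 = begin
    Σℤ.sum (g ∘ index)                 ≡⟨ Σℤ.sum-cong-≗ (onlyOn-∈ member? g ∘ index-valid) ⟨
    Σℤ.sum (onlyOn member? g ∘ index)  ≡⟨ sum-reindex ℤP.+-0-commutativeMonoid _ index
                                            (strictMono⇒injective index index-strictMono) vanish ⟨
    Σℤ.sum (onlyOn member? g)          ≡⟨ sum-onlyOn≡0 ⟩
    0ℤ                                 ∎
    where open ≡-Reasoning

module _ where
  open import Data.Rational.Base using (_*_; 1/_)
  open ≡-Reasoning

  *-zero-cancelˡ : ∀ {c x} → c ≢ 0ℚ → c * x ≡ 0ℚ → x ≡ 0ℚ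
  *-zero-cancelˡ {c} {x} c≢0 cx≡0 = begin
    x                ≡⟨ ℚP.*-identityˡ x ⟨
    1ℚ * x           ≡⟨ cong (_* x) (ℚP.*-inverseˡ c) ⟨
    1/ c * c * x     ≡⟨ ℚP.*-assoc (1/ c) c x ⟩
    1/ c * (c * x)   ≡⟨ cong (1/ c *_) cx≡0 ⟩
    1/ c * 0ℚ        ≡⟨ ℚP.*-zeroʳ (1/ c) ⟩
    0ℚ               ∎
    where instance c-nonZero = ℚ.≢-nonZero c≢0

  RadoCondition-scale : ∀ {n} {a b : Fin n → ℚ} (c : ℚ) → c ≢ 0ℚ → (∀ j → b j ≡ c * a j) →
                        RadoCondition b → RadoCondition a
  RadoCondition-scale {a = a} {b} c c≢0 b≡ca (k , ι , 2≤k , ι-strictMono , b∘ι≢0 , Σb∘ι≡0) =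
    k , ι , 2≤k , ι-strictMono , a∘ι≢0 , *-zero-cancelˡ c≢0 cΣa∘ι≡0
    where
    a∘ι≢0 : ∀ q → a (ι q) ≢ 0ℚ
    a∘ι≢0 q a≡0 = b∘ι≢0 q (trans (b≡ca (ι q)) (trans (cong (c *_) a≡0) (ℚP.*-zeroʳ c)))
    cΣa∘ι≡0 : c * sumℚ (a ∘ ι) ≡ 0ℚ
    cΣa∘ι≡0 = begin
      c * sumℚ (a ∘ ι)               ≡⟨ cong (c *_) (sumℚ≡sum (a ∘ ι)) ⟩
      c * Σℚ.sum (a ∘ ι)             ≡⟨ Σℚ.*-distribˡ-sum c (a ∘ ι) ⟩
      Σℚ.sum (λ q → c * a (ι q))     ≡⟨ Σℚ.sum-cong-≗ (sym ∘ b≡ca ∘ ι) ⟩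
      Σℚ.sum (b ∘ ι)                 ≡⟨ sumℚ≡sum (b ∘ ι) ⟨
      sumℚ (b ∘ ι)                   ≡⟨ Σb∘ι≡0 ⟩
      0ℚ                             ∎

  denominatorProduct : ∀ {n} → (Fin n → ℚ) → ℕ
  denominatorProduct {zero}  a = 1
  denominatorProduct {suc n} a = ↧ₙ a zero ℕ.* denominatorProduct (a ∘ suc)

  denominatorProduct≢0 : ∀ {n} (a : Fin n → ℚ) → denominatorProduct a ≢ 0
  denominatorProduct≢0 {zero}  a ()
  denominatorProduct≢0 {suc n} a eq with ℕP.m*n≡0⇒m≡0∨n≡0 (↧ₙ a zero) eq
  ... | inj₂ rest≡0 = denominatorProduct≢0 (a ∘ suc) rest≡0

  ↧ₙ∣denominatorProduct : ∀ {n} (a : Fin n → ℚ) j → ↧ₙ a j ℕ∣.∣ denominatorProduct a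
  ↧ₙ∣denominatorProduct a zero    = ℕ∣.m∣m*n _
  ↧ₙ∣denominatorProduct a (suc j) = ℕ∣.∣n⇒∣m*n (↧ₙ a zero) (↧ₙ∣denominatorProduct (a ∘ suc) j)

  clearDenominators : ∀ {n} (a : Fin n → ℚ) → ∃ λ (g : Fin n → ℤ) → ∀ j → fromℤ (g j) ≡ ℕtoℚ (denominatorProduct a) * a j
  clearDenominators a = (λ j → + cofactor j ℤ.* ↥ a j) , scaled
    where
    cofactor : ∀ j → ℕ
    cofactor j = ℕ∣._∣_.quotient (↧ₙ∣denominatorProduct a j)
    scaled : ∀ j → fromℤ (+ cofactor j ℤ.* ↥ a j) ≡ ℕtoℚ (denominatorProduct a) * a j
    scaled j = begin
      fromℤ (+ cofactor j ℤ.* ↥ a j)               ≡⟨ fromℤ-* (+ cofactor j) (↥ a j) ⟩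
      fromℤ (+ cofactor j) * fromℤ (↥ a j)         ≡⟨ cong (fromℤ (+ cofactor j) *_) (fromℤ-↥ (a j)) ⟩
      fromℤ (+ cofactor j) * (fromℤ (↧ a j) * a j) ≡⟨ ℚP.*-assoc (fromℤ (+ cofactor j)) (fromℤ (↧ a j)) (a j) ⟨
      fromℤ (+ cofactor j) * fromℤ (↧ a j) * a j   ≡⟨ cong (_* a j) (ℕtoℚ-* (cofactor j) (↧ₙ a j)) ⟨
      ℕtoℚ (cofactor j ℕ.* ↧ₙ a j) * a j           ≡⟨ cong (λ D → ℕtoℚ D * a j) (ℕ∣._∣_.equality (↧ₙ∣denominatorProduct a j)) ⟨
      ℕtoℚ (denominatorProduct a) * a j            ∎

-- Linear forms and Hamming length

module _ where
  open import Data.Rational.Base using (_+_; _*_; _-_)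
  open ≡-Reasoning

  dot : ∀ {n} → (Fin n → ℚ) → (Fin n → ℚ) → ℚ
  dot w y = Σℚ.sum (λ j → w j * y j)

  ℕtoℚ-posLin : ∀ {n} (t α : Vec ℕ n) → ℕtoℚ (posLin t α) ≡ dot (ℕtoℚ ∘ lookup t) (ℕtoℚ ∘ lookup α)
  ℕtoℚ-posLin t α = trans (ℕtoℚ-sum (λ j → lookup t j ℕ.* lookup α j)) (Σℚ.sum-cong-≗ (λ j → ℕtoℚ-* (lookup t j) (lookup α j)))

  sum-sub : ∀ {n} (f g : Fin n → ℚ) → Σℚ.sum (λ j → f j - g j) ≡ Σℚ.sum f - Σℚ.sum g
  sum-sub {zero}  f g = refl
  sum-sub {suc n} f g = trans (cong (_+_ (f zero - g zero)) (sum-sub (f ∘ suc) (g ∘ suc)))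
                              (identity (f zero) (g zero) _ _)
    where
    open +-*-Solver
    identity : ∀ a b S T → (a - b) + (S - T) ≡ (a + S) - (b + T)
    identity = solve 4 (λ a b S T → (a :- b) :+ (S :- T) := (a :+ S) :- (b :+ T)) refl

  dot-sub : ∀ {n} (w y z : Fin n → ℚ) → dot w (λ j → y j - z j) ≡ dot w y - dot w z
  dot-sub w y z = trans (Σℚ.sum-cong-≗ distrib) (sum-sub (λ j → w j * y j) (λ j → w j * z j))
    where
    open +-*-Solver
    identity : ∀ w y z → w * (y - z) ≡ w * y - w * z
    identity = solve 3 (λ w y z → w :* (y :- z) := w :* y :- w :* z) refl
    distrib : ∀ j → w j * (y j - z j) ≡ w j * y j - w j * z j
    distrib j = identity (w j) (y j) (z j)

  dot-combination : ∀ {m n} (w : Fin n → ℚ) (μ : Fin m → ℚ) (x : Fin m → Fin n → ℚ) →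
                    dot w (λ j → Σℚ.sum (λ k → μ k * x k j)) ≡ Σℚ.sum (λ k → μ k * dot w (x k))
  dot-combination w μ x = begin
    Σℚ.sum (λ j → w j * Σℚ.sum (λ k → μ k * x k j))    ≡⟨ Σℚ.sum-cong-≗ (λ j → Σℚ.*-distribˡ-sum (w j) (λ k → μ k * x k j)) ⟩
    Σℚ.sum (λ j → Σℚ.sum (λ k → w j * (μ k * x k j)))  ≡⟨ Σℚ.∑-comm (λ k j → w j * (μ k * x k j)) ⟨
    Σℚ.sum (λ k → Σℚ.sum (λ j → w j * (μ k * x k j)))  ≡⟨ Σℚ.sum-cong-≗ (λ k → Σℚ.sum-cong-≗ (λ j → swap (w j) (μ k) (x k j))) ⟩
    Σℚ.sum (λ k → Σℚ.sum (λ j → μ k * (w j * x k j)))  ≡⟨ Σℚ.sum-cong-≗ (λ k → Σℚ.*-distribˡ-sum (μ k) (λ j → w j * x k j)) ⟨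
    Σℚ.sum (λ k → μ k * dot w (x k))                   ∎
    where
    open +-*-Solver
    swap : ∀ a b c → a * (b * c) ≡ b * (a * c)
    swap = solve 3 (λ a b c → a :* (b :* c) := b :* (a :* c)) refl

isNonzero : ℕ → ℕ
isNonzero zero    = 0
isNonzero (suc _) = 1

hamming≡sum : ∀ {n} (v : Vec ℕ n) → hamming v ≡ Σℕ.sum (isNonzero ∘ lookup v)
hamming≡sum []          = refl
hamming≡sum (zero  ∷ v) = hamming≡sum v
hamming≡sum (suc _ ∷ v) = cong suc (hamming≡sum v)

injective-nonzero≤hamming : ∀ {k n} (v : Vec ℕ n) (ι : Fin k → Fin n) → Injective _≡_ _≡_ ι →
                            (∀ q → lookup v (ι q) ≢ 0) → k ≤ hamming v
injective-nonzero≤hamming v ι ι-injective nonzero =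
  subst (_ ≤_) (sym (hamming≡sum v)) (injective-count≤sum _ ι ι-injective (1≤isNonzero ∘ nonzero))
  where
  1≤isNonzero : ∀ {x} → x ≢ 0 → 1 ≤ isNonzero x
  1≤isNonzero {zero}  x≢0 = contradiction refl x≢0
  1≤isNonzero {suc _} _   = s≤s z≤n

RadoCondition⇒sum≡0 : ∀ {n} {a : Fin n → ℚ} (v : Vec ℕ n) → (∀ j → a j ≢ 0ℚ → lookup v j ≢ 0) →
                      hamming v ≤ 2 → RadoCondition a → Σℚ.sum a ≡ 0ℚ
RadoCondition⇒sum≡0 {a = a} v support ham (k , ι , 2≤k , ι-strictMono , a∘ι≢0 , Σa∘ι≡0) =
  trans (sum-reindex ℚP.+-0-commutativeMonoid a ι ι-injective vanish) (trans (sym (sumℚ≡sum (a ∘ ι))) Σa∘ι≡0)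
  where
  ι-injective = strictMono⇒injective ι ι-strictMono
  vanish : ∀ j → (∀ q → ι q ≢ j) → a j ≡ 0ℚ
  vanish j missed with a j ℚ.≟ 0ℚ
  ... | yes a≡0 = a≡0
  -- Otherwise j together with the k ≥ 2 indices of ι would be three nonzero coordinates of v.
  ... | no  a≢0 = contradiction (ℕP.≤-trans (s≤s 2≤k) (ℕP.≤-trans 1+k≤hamming ham)) ℕP.1+n≰n
    where
    nonzero : ∀ q → lookup v ((j Vector.∷ ι) q) ≢ 0
    nonzero zero    = support j a≢0
    nonzero (suc q) = support (ι q) (a∘ι≢0 q)
    1+k≤hamming = injective-nonzero≤hamming v (j Vector.∷ ι) (cons-injective ι-injective missed) nonzero

-- Rado partitions

module _ {n ℓ} (P : Poly n) (J : Tuple n ℓ) where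
  open import Data.Rational.Base using (_*_; _-_)
  open ≡-Reasoning

  member⇒posLin≡level : ∀ t (det : DeterminedBy P t J) {i α} → J i α → posLin t α ≡ proj₁ det i
  member⇒posLin≡level t (_ , _ , _ , _ , iff) {i} {α} = proj₂ ∘ Equivalence.to (iff i α)

  posLin≡level⇒member : ∀ t (det : DeterminedBy P t J) {i γ} → γ ∈Supp P → posLin t γ ≡ proj₁ det i → J i γ
  posLin≡level⇒member t (_ , _ , _ , _ , iff) {i} {γ} γ∈P = Equivalence.from (iff i γ) ∘ (γ∈P ,_)

  span-orthogonal : ∀ t → DeterminedBy P t J → ∀ {i a} → InSpanE (J i) a → dot (ℕtoℚ ∘ lookup t) a ≡ 0ℚ
  span-orthogonal t det {i} {a} (m , μ , α , β , Jα , Jβ , a≡) = begin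
    dot T a
      ≡⟨ Σℚ.sum-cong-≗ (λ j → cong (T j *_) (trans (a≡ j) (sumℚ≡sum (λ k → μ k * (A k j - B k j))))) ⟩
    dot T (λ j → Σℚ.sum (λ k → μ k * (A k j - B k j)))     ≡⟨ dot-combination T μ (λ k j → A k j - B k j) ⟩
    Σℚ.sum (λ k → μ k * dot T (λ j → A k j - B k j))       ≡⟨ Σℚ.sum-cong-≗ (λ k → cong (μ k *_) (level-difference k)) ⟩
    Σℚ.sum (λ k → μ k * 0ℚ)                                ≡⟨ Σℚ.sum-cong-≗ (λ k → ℚP.*-zeroʳ (μ k)) ⟩
    Σℚ.sum {m} (λ _ → 0ℚ)                                  ≡⟨ Σℚ.sum-replicate-zero m ⟩
    0ℚ                                                     ∎
    where
    T = ℕtoℚ ∘ lookup t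
    A B : Fin m → Fin n → ℚ
    A k = ℕtoℚ ∘ lookup (α k)
    B k = ℕtoℚ ∘ lookup (β k)
    level : ∀ {γ} → J i γ → dot T (ℕtoℚ ∘ lookup γ) ≡ ℕtoℚ (proj₁ det i)
    level {γ} Jγ = trans (sym (ℕtoℚ-posLin t γ)) (cong ℕtoℚ (member⇒posLin≡level t det Jγ))
    level-difference : ∀ k → dot T (λ j → A k j - B k j) ≡ 0ℚ
    level-difference k = trans (dot-sub T (A k) (B k)) (trans (cong₂ _-_ (level (Jα k)) (level (Jβ k))) (ℚP.+-inverseʳ (ℕtoℚ (proj₁ det i))))

  RadoPartition⇒convex : RadoPartition P J → ∀ i m (α : Fin m → Vec ℕ n) (λs : Fin m → ℚ) (γ : Vec ℕ n) →
                         (∀ k → J i (α k)) → sumℚ λs ≡ 1ℚ → γ ∈Supp P →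
                         (∀ j → sumℚ (λ k → λs k * ℕtoℚ (lookup (α k) j)) ≡ ℕtoℚ (lookup γ j)) → J i γ
  RadoPartition⇒convex rado i m α λs γ Jα Σλ≡1 γ∈P γ≡Σλα with rado 1 (λ _ → zero) []
  ... | t , _ , _ , det = posLin≡level⇒member t det γ∈P (ℕtoℚ-injective (begin
    ℕtoℚ (posLin t γ)                                ≡⟨ ℕtoℚ-posLin t γ ⟩
    dot T (ℕtoℚ ∘ lookup γ)
      ≡⟨ Σℚ.sum-cong-≗ (λ j → cong (T j *_) (trans (sym (γ≡Σλα j)) (sumℚ≡sum (λ k → λs k * A k j)))) ⟩
    dot T (λ j → Σℚ.sum (λ k → λs k * A k j))        ≡⟨ dot-combination T λs A ⟩
    Σℚ.sum (λ k → λs k * dot T (A k))                ≡⟨ Σℚ.sum-cong-≗ (λ k → cong (λs k *_) (level k)) ⟩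
    Σℚ.sum (λ k → λs k * Mᵢ)                         ≡⟨ Σℚ.*-distribʳ-sum Mᵢ λs ⟨
    Σℚ.sum λs * Mᵢ                                   ≡⟨ cong (_* Mᵢ) (trans (sym (sumℚ≡sum λs)) Σλ≡1) ⟩
    1ℚ * Mᵢ                                          ≡⟨ ℚP.*-identityˡ Mᵢ ⟩
    Mᵢ                                               ∎))
    where
    T = ℕtoℚ ∘ lookup t
    A : Fin m → Fin n → ℚ
    A k = ℕtoℚ ∘ lookup (α k)
    Mᵢ = ℕtoℚ (proj₁ det i)
    level : ∀ k → dot T (A k) ≡ Mᵢ
    level k = trans (sym (ℕtoℚ-posLin t (α k))) (cong ℕtoℚ (member⇒posLin≡level t det (Jα k)))

  positiveMonochromaticMap : RadoPartition P J → ∀ {p} (p-prime : Prime p) →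
    ∃ λ t → (∀ j → lookup t j ≢ 0) × Monochromatic (LastDigitColouring.lastDigit p-prime) t × DeterminedBy P t J
  positiveMonochromaticMap rado {p} p-prime with rado p (LastDigitColouring.lastDigit p-prime) (replicate n 0 ∷ [])
  ... | t , t∉[0] , mono , det = t , t≢0 , mono , det
    where
    open LastDigitColouring p-prime
    -- Only 0 has the colour of 0, so a zero coordinate would make t the excluded zero vector.
    t≢0 : ∀ j → lookup t j ≢ 0
    t≢0 j tj≡0 = t∉[0] (here (begin
      t                                 ≡⟨ VecP.tabulate∘lookup t ⟨
      tabulate (lookup t)               ≡⟨ VecP.tabulate-cong (λ k → trans (all-zero k) (sym (VecP.lookup-replicate k 0))) ⟩
      tabulate (lookup (replicate n 0)) ≡⟨ VecP.tabulate∘lookup (replicate n 0) ⟩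
      replicate n 0                     ∎))
      where
      all-zero : ∀ k → lookup t k ≡ 0
      all-zero k with lookup t k ℕ.≟ 0
      ... | yes tk≡0 = tk≡0
      ... | no  tk≢0 = contradiction (trans (mono k j) (cong lastDigit tj≡0)) (lastDigit-nonzero _ {{ℕ.≢-nonZero tk≢0}})

  RadoPartition⇒spanRado : RadoPartition P J → ∀ i (a : Fin n → ℚ) → NonzeroForm a → InSpanE (J i) a → RadoCondition a
  RadoPartition⇒spanRado rado i a a≢0 a∈E =
    RadoCondition-scale (ℕtoℚ D) (denominatorProduct≢0 a ∘ ℕtoℚ-injective) g≡Da
      (ZeroSumSubset⇒RadoCondition (monochromatic⇒zeroSumSubset g (lookup t) bound t≢0 mono Σgt≡0 g≢0))
    where
    D = denominatorProduct a
    g = proj₁ (clearDenominators a)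
    g≡Da = proj₂ (clearDenominators a)
    prime = ∃prime> (Σℕ.sum (∣_∣ ∘ g))
    p-prime = proj₁ (proj₂ prime)
    bound = proj₂ (proj₂ prime)
    open LastDigitColouring p-prime
    monochromatic = positiveMonochromaticMap rado p-prime
    t = proj₁ monochromatic
    t≢0 = proj₁ (proj₂ monochromatic)
    mono = proj₁ (proj₂ (proj₂ monochromatic))
    det = proj₂ (proj₂ (proj₂ monochromatic))
    T = ℕtoℚ ∘ lookup t
    Σgt≡0 : Σℤ.sum (λ j → g j ℤ.* + lookup t j) ≡ 0ℤ
    Σgt≡0 = fromℤ-injective (begin
      fromℤ (Σℤ.sum (λ j → g j ℤ.* + lookup t j))   ≡⟨ fromℤ-sum (λ j → g j ℤ.* + lookup t j) ⟩
      Σℚ.sum (λ j → fromℤ (g j ℤ.* + lookup t j))   ≡⟨ Σℚ.sum-cong-≗ (λ j → trans (fromℤ-* (g j) _) (cong (_* T j) (g≡Da j))) ⟩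
      Σℚ.sum (λ j → ℕtoℚ D * a j * T j)
        ≡⟨ Σℚ.sum-cong-≗ (λ j → trans (ℚP.*-assoc (ℕtoℚ D) (a j) (T j)) (cong (ℕtoℚ D *_) (ℚP.*-comm (a j) (T j)))) ⟩
      Σℚ.sum (λ j → ℕtoℚ D * (T j * a j))           ≡⟨ Σℚ.*-distribˡ-sum (ℕtoℚ D) (λ j → T j * a j) ⟨
      ℕtoℚ D * dot T a                              ≡⟨ cong (ℕtoℚ D *_) (span-orthogonal t det a∈E) ⟩
      ℕtoℚ D * 0ℚ                                   ≡⟨ ℚP.*-zeroʳ (ℕtoℚ D) ⟩
      0ℚ                                            ∎)
    g≢0 : ∃ λ j → g j ≢ 0ℤ
    g≢0 with FinP.¬∀⟶∃¬ n _ (λ j → a j ℚ.≟ 0ℚ) a≢0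
    ... | j , aj≢0 = j , λ gj≡0 → aj≢0 (*-zero-cancelˡ (denominatorProduct≢0 a ∘ ℕtoℚ-injective)
                                         (trans (sym (g≡Da j)) (cong fromℤ gj≡0)))

  RadoPartition⇒equalDegree : RadoPartition P J → ∀ i (α β : Vec ℕ n) → J i α → J i β →
                              hamming (α +ᵥ β) ≤ 2 → ∣ α ∣ₘ ≡ ∣ β ∣ₘ
  RadoPartition⇒equalDegree rado i α β Jα Jβ ham = ℕtoℚ-injective (x∙y⁻¹≈ε⇒x≈y _ _ (begin
    ℕtoℚ ∣ α ∣ₘ - ℕtoℚ ∣ β ∣ₘ                        ≡⟨ cong₂ _-_ (ℕtoℚ-sum (lookup α)) (ℕtoℚ-sum (lookup β)) ⟩
    Σℚ.sum (ℕtoℚ ∘ lookup α) - Σℚ.sum (ℕtoℚ ∘ lookup β) ≡⟨ sum-sub (ℕtoℚ ∘ lookup α) (ℕtoℚ ∘ lookup β) ⟨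
    Σℚ.sum a                                           ≡⟨ Σa≡0 (FinP.all? (λ j → a j ℚ.≟ 0ℚ)) ⟩
    0ℚ                                                 ∎))
    where
    open import Algebra.Properties.Group ℚP.+-0-group using (x∙y⁻¹≈ε⇒x≈y)
    a : Fin n → ℚ
    a j = ℕtoℚ (lookup α j) - ℕtoℚ (lookup β j)
    a∈E : InSpanE (J i) a
    a∈E = 1 , (λ _ → 1ℚ) , (λ _ → α) , (λ _ → β) , (λ _ → Jα) , (λ _ → Jβ) ,
          λ j → sym (trans (ℚP.+-identityʳ _) (ℚP.*-identityˡ (a j)))
    support : ∀ j → a j ≢ 0ℚ → lookup (α +ᵥ β) j ≢ 0
    support j aj≢0 αj+βj≡0 =
      aj≢0 (cong₂ (λ x y → ℕtoℚ x - ℕtoℚ y) (ℕP.m+n≡0⇒m≡0 (lookup α j) sum≡0) (ℕP.m+n≡0⇒n≡0 (lookup α j) sum≡0))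
      where sum≡0 = trans (sym (VecP.lookup-zipWith ℕ._+_ j α β)) αj+βj≡0
    Σa≡0 : Dec (∀ j → a j ≡ 0ℚ) → Σℚ.sum a ≡ 0ℚ
    Σa≡0 (yes a≡0) = trans (Σℚ.sum-cong-≗ a≡0) (Σℚ.sum-replicate-zero n)
    Σa≡0 (no  a≢0) = RadoCondition⇒sum≡0 (α +ᵥ β) support ham (RadoPartition⇒spanRado rado i a a≢0 a∈E)

open import Data.Rational.Base using (_*_)

proposition2p11 : ∀ {n ℓ : ℕ} (P : Poly n) (J : Tuple n ℓ) → RadoPartition P J →
    ∀ (i : Fin (suc ℓ)) →
      (∀ (m : ℕ) (α : Fin m → Vec ℕ n) (λs : Fin m → ℚ) (γ : Vec ℕ n) →
          (∀ k → J i (α k)) → sumℚ λs ≡ 1ℚ → γ ∈Supp P →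
          (∀ j → sumℚ (λ k → λs k * ℕtoℚ (lookup (α k) j)) ≡ ℕtoℚ (lookup γ j)) →
          J i γ)
      × (∀ (a : Fin n → ℚ) → NonzeroForm a → InSpanE (J i) a → RadoCondition a)
      × (∀ (α β : Vec ℕ n) → J i α → J i β → hamming (α +ᵥ β) ≤ 2 → ∣ α ∣ₘ ≡ ∣ β ∣ₘ)
proposition2p11 P J rado i =
  RadoPartition⇒convex P J rado i , RadoPartition⇒spanRado P J rado i , RadoPartition⇒equalDegree P J rado i
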